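{- Assume $p>4d-\varepsilon(u)$, let $1\le n\le d-1$ and let $\tau$ be a permutation of $A_n=\{0,1,\dots,n-1\}$. Then $$\sum_{i=1}^b\sum_{l=0}^{n-1}\Big\lceil\frac{pl+u_{b-i}-\tau(l)}{d}\Big\rceil\ \ge\ b\,P_{[0,d],u}(n),$$ with equality if and only if $\tau\in S_{n,i}$ for every $1\le i\le b$.
   Context: Let $p$ be a prime, $q=p^a$, $d\ge1$, $0\le u\le q-2$ with digits $u=\sum_{j=0}^{a-1}u_jp^j$ extended by $u_{j+a}=u_j$; $b$ least positive integer with $p^bu\equiv u\pmod{q-1}$ (so $u_{j+b}=u_j$). $\{x\}$ fractional part, $\lceil x\rceil$ ceiling, $\{x\}'=1+x-\lceil x\rceil$, $\varepsilon(u)=\min\{d\{u_i/d\}':1\le i\le b\}$. Arithmetic polygon: for $0\le i\le b-1$, $\delta^{(i)}_{\in}(0)=0$, and for $m\ge1$, $\delta^{(i)}_{\in}(m)=1$ if some integer $0\le l<d\{m/d\}$ has $pl+u_{b-i}\equiv m\pmod d$, else $0$; $\omega(m)=\frac1b\sum_{i=0}^{b-1}(\lceil\frac{(p-1)m+u_{b-i}}{d}\rceil-\delta^{(i)}_{\in}(m))$; $P_{[0,d],u}(n)=\sum_{k=0}^{n-1}\omega(k)$. $S_n$ is the set of permutations of $A_n$, and for $1\le i\le b$, $S_{n,i}=\{\tau\in S_n:\ \frac{\tau(l)}{d}\ge\frac{pl+u_{b-i}}{d}-\lceil\frac{pl+u_{b-i}-(n-1)}{d}\rceil\text{ for all }l\in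 A_n\}$. -}

module Defs where

open import Data.Nat as ℕ using (ℕ; zero; suc; _+_; _*_; _∸_; _⊓_; NonZero; _%_; _≡ᵇ_)
import Data.Nat.DivMod as ℕD
open import Data.Integer as ℤ using (ℤ; +_; -_; _/ℕ_)
open import Data.Rational as ℚ using (ℚ)
open import Data.Fin using (Fin; toℕ) renaming (zero to fzero; suc to fsuc)
open import Data.Fin.Permutation using (Permutation′; _⟨$⟩ʳ_)
open import Data.Bool using (Bool; true; false; if_then_else_; _∨_)
open import Data.Product using (_×_)
open import Relation.Binary.PropositionalEquality using (_≡_)

ΣFin : (n : ℕ) → (Fin n → ℤ) → ℤ
ΣFin zero    f = + 0
ΣFin (suc n) f = f fzero ℤ.+ ΣFin n (λ i → f (fsuc i))

Σ< : ℕ → (ℕ → ℤ) → ℤ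
Σ< zero    f = + 0
Σ< (suc n) f = Σ< n f ℤ.+ f n

Σ<ℚ : ℕ → (ℕ → ℚ) → ℚ
Σ<ℚ zero    f = ℚ.0ℚ
Σ<ℚ (suc n) f = Σ<ℚ n f ℚ.+ f n

⌈_/_⌉ : ℤ → (d : ℕ) → .{{NonZero d}} → ℤ
⌈ x / d ⌉ = - ((- x) /ℕ d)

digitK : (p : ℕ) → .{{NonZero p}} → ℕ → ℕ → ℕ
digitK p zero    u = u % p
digitK p (suc k) u = digitK p k (u ℕD./ p)

udig : (p a u : ℕ) → .{{NonZero p}} → .{{NonZero a}} → ℕ → ℕ
udig p a u j = digitK p (j % a) u

-- d {x/d}' = d (1 + x/d - ⌈x/d⌉) = d + x - d⌈x/d⌉, for a natural x.
dFracPrime : (d : ℕ) → .{{NonZero d}} → ℕ → ℤ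
dFracPrime d x = (+ d ℤ.+ + x) ℤ.- (+ d) ℤ.* ⌈ + x / d ⌉

minFrom1 : (ℕ → ℤ) → ℕ → ℤ
minFrom1 f zero    = f 1
minFrom1 f (suc n) = minFrom1 f n ℤ.⊓ f (suc (suc n))

epsilon : (p a d u b : ℕ) → .{{NonZero p}} → .{{NonZero a}} → .{{NonZero d}} → ℤ
epsilon p a d u b = minFrom1 (λ i → dFracPrime d (udig p a u i)) (b ∸ 1)

anyBelow : ℕ → (ℕ → Bool) → Bool
anyBelow zero    P = false
anyBelow (suc n) P = anyBelow n P ∨ P n

-- δ^{(i)}_∈(m): for m ≥ 1, 1 iff some integer 0 ≤ l < d{m/d} (= m mod d)
-- satisfies p l + u_{b-i} ≡ m (mod d); δ(0) = 0.
delta : (p a d u b : ℕ) → .{{NonZero p}} → .{{NonZero a}} → .{{NonZero d}} → ℕ → ℕ → ℤ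
delta p a d u b i zero    = + 0
delta p a d u b i (suc m) =
  if anyBelow (suc m % d) (λ l → ((p * l + udig p a u (b ∸ i)) % d) ≡ᵇ (suc m % d))
  then + 1 else + 0

omega : (p a d u b : ℕ) → .{{NonZero p}} → .{{NonZero a}} → .{{NonZero d}} → .{{NonZero b}} → ℕ → ℚ
omega p a d u b m =
  (Σ< b (λ i → ⌈ + ((p ∸ 1) * m + udig p a u (b ∸ i)) / d ⌉ ℤ.- delta p a d u b i m)) ℚ./ b

Ppoly : (p a d u b : ℕ) → .{{NonZero p}} → .{{NonZero a}} → .{{NonZero d}} → .{{NonZero b}} → ℕ → ℚ
Ppoly p a d u b n = Σ<ℚ n (omega p a d u b)

τat : {n : ℕ} → Permutation′ n → Fin n → ℕ
τat τ l = toℕ (τ ⟨$⟩ʳ l)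

lhsSum : (p a d u b n : ℕ) → .{{NonZero p}} → .{{NonZero a}} → .{{NonZero d}} → Permutation′ n → ℤ
lhsSum p a d u b n τ =
  Σ< b (λ i' → ΣFin n (λ l →
    ⌈ (+ (p * toℕ l + udig p a u (b ∸ suc i')) ℤ.- + τat τ l) / d ⌉))

inS : (p a d u b n : ℕ) → .{{NonZero p}} → .{{NonZero a}} → .{{NonZero d}} → ℕ → Permutation′ n → Set
inS p a d u b n i τ = (l : Fin n) →
  (+ (τat τ l)) ℚ./ d ℚ.≥
    ((+ (p * toℕ l + udig p a u (b ∸ i))) ℚ./ d)
      ℚ.- (⌈ + (p * toℕ l + udig p a u (b ∸ i)) ℤ.- + (n ∸ 1) / d ⌉ ℚ./ 1)

module Submission where

-- Write c = p·l + u_j for a cell of the left-hand side and t = τ(l) ≤ n − 1.  Ceiling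
-- division is monotone, so each summand ⌈(c − t)/d⌉ is at least ⌈(c − (n − 1))/d⌉, and
-- through the Galois connection ⌈x/d⌉ ≤ k ⇔ x ≤ k·d this bound is attained exactly when
-- the inequality defining S_{n,i} holds at l.  For a fixed digit, the sum of the bounds
-- over l is Σ_m (⌈((p − 1)m + u_j)/d⌉ − δ_∈(m)): the formula ⌈(c − t)/d⌉ = ⌊c/d⌋ + [t < c mod d]
-- reduces this to a counting identity for the residues (p·l + u_j) mod d, which are
-- distinct since p is a prime larger than d (p > 4d − ε ≥ 3d).  Summing over the b digits
-- and using u_b = u_0 (b is the period of the digits) gives b·P_{[0,d],u}(n).

open import Defs
open import Data.Nat as ℕ using (ℕ; _+_; _*_; _∸_; _^_; _≤_; _<_; NonZero)
open import Data.Nat.Divisibility using (_∣_)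
open import Data.Nat.Primality using (Prime)
open import Data.Integer as ℤ using (+_)
open import Data.Rational as ℚ using (ℚ)
open import Data.Fin.Permutation using (Permutation′)
open import Data.Product using (_×_)
open import Function.Bundles using (_⇔_)
open import Relation.Nullary using (¬_)
open import Relation.Binary.PropositionalEquality using (_≡_)

open import Data.Nat using (zero; suc; z≤n; s≤s)
import Data.Nat.Properties as NP
open import Data.Nat.DivMod using (_/_; _%_)
import Data.Nat.DivMod as ND
open import Data.Nat.Divisibility using (divides; ∣⇒≤; m∣m*n; n∣m*n)
open import Data.Nat.Coprimality using (prime⇒coprime; coprime-divisor)
import Data.Nat.Coprimality as Coprimality
import Data.Nat.Tactic.RingSolver as ℕ-Ring
open import Data.Integer using (ℤ; -_; _/ℕ_; +≤+; +<+)
import Data.Integer.Properties as ZP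
import Data.Integer.DivMod as ZD
import Data.Integer.Tactic.RingSolver as ℤ-Ring
import Data.Rational.Properties as QP
open import Data.Rational.Unnormalised as U using (mkℚᵘ; *≡*; *≤*)
import Data.Rational.Unnormalised.Properties as UP
open import Data.Fin using (Fin; toℕ) renaming (zero to fzero; suc to fsuc)
import Data.Fin.Properties as FP
open import Data.Fin.Permutation using (_⟨$⟩ʳ_)
open import Data.Bool using (Bool; true; false; if_then_else_; T)
open import Data.Bool.Properties using (∨-identityʳ; ∨-zeroʳ)
open import Data.Empty using (⊥; ⊥-elim)
open import Data.Sum using (inj₁; inj₂)
open import Data.Product using (Σ-syntax; _,_)
open import Function.Bundles using (mk⇔; Equivalence)
open import Relation.Nullary using (ofʸ; ofⁿ)
open import Relation.Binary.PropositionalEquality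
  using (_≢_; refl; sym; trans; cong; cong₂; subst; subst₂; module ≡-Reasoning)

open Equivalence using (to; from)
import Function.Properties.Equivalence as ⇔
open ≡-Reasoning

+-tight : ∀ {a a' b b' : ℤ} → a ℤ.≤ a' → b ℤ.≤ b' → a' ℤ.+ b' ≡ a ℤ.+ b → a' ≡ a × b' ≡ b
+-tight a≤a' b≤b' eq =
  ZP.≤-antisym (ZP.≮⇒≥ λ a<a' → ZP.<-irrefl (sym eq) (ZP.+-mono-<-≤ a<a' b≤b')) a≤a' ,
  ZP.≤-antisym (ZP.≮⇒≥ λ b<b' → ZP.<-irrefl (sym eq) (ZP.+-mono-≤-< a≤a' b<b')) b≤b'

restrict : ∀ {n} {P : ℕ → Set} → (∀ i → i < suc n → P i) → ∀ i → i < n → P i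
restrict h i i<n = h i (NP.m<n⇒m<1+n i<n)

Σ<-cong : ∀ n {f g : ℕ → ℤ} → (∀ i → i < n → f i ≡ g i) → Σ< n f ≡ Σ< n g
Σ<-cong zero    f≡g = refl
Σ<-cong (suc n) f≡g = cong₂ ℤ._+_ (Σ<-cong n (restrict f≡g)) (f≡g n NP.≤-refl)

Σ<-+ : ∀ n (f g : ℕ → ℤ) → Σ< n (λ i → f i ℤ.+ g i) ≡ Σ< n f ℤ.+ Σ< n g
Σ<-+ zero    f g = refl
Σ<-+ (suc n) f g = trans (cong (ℤ._+ (f n ℤ.+ g n)) (Σ<-+ n f g)) (interchange (Σ< n f) (Σ< n g) (f n) (g n))
  where
  interchange : ∀ a b c e → (a ℤ.+ b) ℤ.+ (c ℤ.+ e) ≡ (a ℤ.+ c) ℤ.+ (b ℤ.+ e)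
  interchange = ℤ-Ring.solve-∀

Σ<-- : ∀ n (f g : ℕ → ℤ) → Σ< n (λ i → f i ℤ.- g i) ≡ Σ< n f ℤ.- Σ< n g
Σ<-- zero    f g = refl
Σ<-- (suc n) f g = trans (cong (ℤ._+ (f n ℤ.- g n)) (Σ<-- n f g)) (interchange (Σ< n f) (Σ< n g) (f n) (g n))
  where
  interchange : ∀ a b c e → (a ℤ.- b) ℤ.+ (c ℤ.- e) ≡ (a ℤ.+ c) ℤ.- (b ℤ.+ e)
  interchange = ℤ-Ring.solve-∀

Σ<-zero : ∀ n → Σ< n (λ _ → + 0) ≡ + 0
Σ<-zero zero    = refl
Σ<-zero (suc n) = cong (ℤ._+ + 0) (Σ<-zero n)

Σ<-swap : ∀ n b (F : ℕ → ℕ → ℤ) → Σ< n (λ m → Σ< b (F m)) ≡ Σ< b (λ i → Σ< n (λ m → F m i))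
Σ<-swap zero    b F = sym (Σ<-zero b)
Σ<-swap (suc n) b F =
  trans (cong (ℤ._+ Σ< b (F n)) (Σ<-swap n b F)) (sym (Σ<-+ b (λ i → Σ< n (λ m → F m i)) (F n)))

Σ<-first : ∀ k (f : ℕ → ℤ) → Σ< (suc k) f ≡ f 0 ℤ.+ Σ< k (λ i → f (suc i))
Σ<-first zero    f = trans (ZP.+-identityˡ (f 0)) (sym (ZP.+-identityʳ (f 0)))
Σ<-first (suc k) f = trans (cong (ℤ._+ f (suc k)) (Σ<-first k f)) (ZP.+-assoc (f 0) _ (f (suc k)))

-- Reading the summation range b, b-1, …, 1 as b-1, …, 0 only swaps the values at b and 0.
Σ<-rotate : ∀ b (F : ℕ → ℤ) → F b ≡ F 0 → Σ< b (λ i → F (b ∸ i)) ≡ Σ< b (λ i → F (b ∸ suc i))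
Σ<-rotate zero    F _    = refl
Σ<-rotate (suc b) F Fb≡F0 = begin
  Σ< (suc b) (λ i → F (suc b ∸ i))       ≡⟨ Σ<-first b (λ i → F (suc b ∸ i)) ⟩
  F (suc b) ℤ.+ Σ< b (λ i → F (b ∸ i))   ≡⟨ ZP.+-comm (F (suc b)) _ ⟩
  Σ< b (λ i → F (b ∸ i)) ℤ.+ F (suc b)   ≡⟨ cong (λ z → Σ< b (λ i → F (b ∸ i)) ℤ.+ z) Fb≡Fb-b ⟩
  Σ< b (λ i → F (b ∸ i)) ℤ.+ F (b ∸ b)   ∎
  where
  Fb≡Fb-b : F (suc b) ≡ F (b ∸ b)
  Fb≡Fb-b = trans Fb≡F0 (cong F (sym (NP.n∸n≡0 b)))

Σ<-mono : ∀ n {f g : ℕ → ℤ} → (∀ i → i < n → g i ℤ.≤ f i) → Σ< n g ℤ.≤ Σ< n f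
Σ<-mono zero    g≤f = ZP.≤-refl
Σ<-mono (suc n) g≤f = ZP.+-mono-≤ (Σ<-mono n (restrict g≤f)) (g≤f n NP.≤-refl)

Σ<-tight : ∀ n {f g : ℕ → ℤ} → (∀ i → i < n → g i ℤ.≤ f i) →
  Σ< n f ≡ Σ< n g → ∀ i → i < n → f i ≡ g i
Σ<-tight (suc n) g≤f eq i i<1+n
  with +-tight (Σ<-mono n (restrict g≤f)) (g≤f n NP.≤-refl) eq | NP.m≤n⇒m<n∨m≡n (NP.≤-pred i<1+n)
... | sums≡ , _     | inj₁ i<n  = Σ<-tight n (restrict g≤f) sums≡ i i<n
... | _     , last≡ | inj₂ refl = last≡

ΣFin-cong : ∀ n {f g : Fin n → ℤ} → (∀ l → f l ≡ g l) → ΣFin n f ≡ ΣFin n g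
ΣFin-cong zero    f≡g = refl
ΣFin-cong (suc n) f≡g = cong₂ ℤ._+_ (f≡g fzero) (ΣFin-cong n (λ l → f≡g (fsuc l)))

ΣFin-mono : ∀ n {f g : Fin n → ℤ} → (∀ l → g l ℤ.≤ f l) → ΣFin n g ℤ.≤ ΣFin n f
ΣFin-mono zero    g≤f = ZP.≤-refl
ΣFin-mono (suc n) g≤f = ZP.+-mono-≤ (g≤f fzero) (ΣFin-mono n (λ l → g≤f (fsuc l)))

ΣFin-tight : ∀ n {f g : Fin n → ℤ} → (∀ l → g l ℤ.≤ f l) → ΣFin n f ≡ ΣFin n g → ∀ l → f l ≡ g l
ΣFin-tight (suc n) g≤f eq l with +-tight (g≤f fzero) (ΣFin-mono n (λ l → g≤f (fsuc l))) eq
ΣFin-tight (suc n) g≤f eq fzero    | head≡ , _     = head≡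
ΣFin-tight (suc n) g≤f eq (fsuc l) | _     , tail≡ = ΣFin-tight n (λ l → g≤f (fsuc l)) tail≡ l

ΣFin-toℕ : ∀ n (f : ℕ → ℤ) → ΣFin n (λ l → f (toℕ l)) ≡ Σ< n f
ΣFin-toℕ zero    f = refl
ΣFin-toℕ (suc n) f = trans (cong (λ z → f 0 ℤ.+ z) (ΣFin-toℕ n (λ i → f (suc i)))) (sym (Σ<-first n f))

sub-swap : ∀ a b c → a ℤ.- b ℤ.≤ c → a ℤ.- c ℤ.≤ b
sub-swap a b c le = subst₂ ℤ._≤_ (ZP.+-minus-telescope a b c) (cancel c b) (ZP.+-monoˡ-≤ (b ℤ.- c) le)
  where
  cancel : ∀ c b → c ℤ.+ (b ℤ.- c) ≡ b
  cancel = ℤ-Ring.solve-∀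

pos-+-minus : ∀ x y → + (x + y) ℤ.- + y ≡ + x
pos-+-minus x y = cancel (+ x) (+ y)
  where
  cancel : ∀ x y → (x ℤ.+ y) ℤ.- y ≡ x
  cancel = ℤ-Ring.solve-∀

ℕ-shift : ∀ c t e m → c + e ≡ m + t → + c ℤ.- + t ℤ.+ + e ≡ + m
ℕ-shift c t e m eq = begin
  + c ℤ.- + t ℤ.+ + e    ≡⟨ regroup (+ c) (+ t) (+ e) ⟩
  + (c + e) ℤ.- + t      ≡⟨ cong (λ z → + z ℤ.- + t) eq ⟩
  + (m + t) ℤ.- + t      ≡⟨ pos-+-minus m t ⟩
  + m                    ∎
  where
  regroup : ∀ c t e → c ℤ.- t ℤ.+ e ≡ (c ℤ.+ e) ℤ.- t
  regroup = ℤ-Ring.solve-∀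

ind : Bool → ℤ
ind b = if b then + 1 else + 0

-- Ceiling division by a fixed positive d.  Everything is derived from the
-- representation x + e = ⌈x/d⌉·d with 0 ≤ e < d.
module Ceiling (d : ℕ) .{{_ : NonZero d}} where

  ceil-rep : ∀ x → Σ[ e ∈ ℕ ] e < d × x ℤ.+ + e ≡ ⌈ x / d ⌉ ℤ.* + d
  ceil-rep x = r , ZD.n%ℕd<d (- x) d , (begin
      x ℤ.+ + r                      ≡⟨ cong (ℤ._+ + r) (sym (ZP.neg-involutive x)) ⟩
      - (- x) ℤ.+ + r                ≡⟨ cong (λ y → - y ℤ.+ + r) (ZD.a≡a%ℕn+[a/ℕn]*n (- x) d) ⟩
      - (+ r ℤ.+ q ℤ.* + d) ℤ.+ + r  ≡⟨ negate (+ r) q (+ d) ⟩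
      - q ℤ.* + d                    ∎)
    where
    r = (- x) ZD.%ℕ d
    q = (- x) /ℕ d
    negate : ∀ r q d → - (r ℤ.+ q ℤ.* d) ℤ.+ r ≡ (- q) ℤ.* d
    negate = ℤ-Ring.solve-∀

  quotient-≤ : ∀ {k k' : ℤ} {e : ℕ} → e < d → k ℤ.* + d ℤ.≤ k' ℤ.* + d ℤ.+ + e → k ℤ.≤ k'
  quotient-≤ {k} {k'} {e} e<d kd≤ =
    subst (k ℤ.≤_) (ZP.pred-suc k')
      (ZP.i<j⇒i≤pred[j] (ZP.*-cancelʳ-<-nonNeg {i = k} {j = ℤ.suc k'} (+ d) (ZP.≤-<-trans kd≤ below)))
    where
    below : k' ℤ.* + d ℤ.+ + e ℤ.< ℤ.suc k' ℤ.* + d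
    below = subst (k' ℤ.* + d ℤ.+ + e ℤ.<_) (trans (ZP.+-comm (k' ℤ.* + d) (+ d)) (sym (ZP.suc-* k' (+ d))))
                  (ZP.+-monoʳ-< (k' ℤ.* + d) (+<+ e<d))

  ≤-ceil-mult : ∀ x → x ℤ.≤ ⌈ x / d ⌉ ℤ.* + d
  ≤-ceil-mult x with ceil-rep x
  ... | e , _ , eq = subst (x ℤ.≤_) eq (ZP.i≤i+j x (+ e))

  ceil-≤ : ∀ {x k} → x ℤ.≤ k ℤ.* + d → ⌈ x / d ⌉ ℤ.≤ k
  ceil-≤ {x} {k} x≤kd with ceil-rep x
  ... | e , e<d , eq = quotient-≤ e<d (subst (ℤ._≤ k ℤ.* + d ℤ.+ + e) eq (ZP.+-monoˡ-≤ (+ e) x≤kd))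

  ceil-mono : ∀ {x y} → x ℤ.≤ y → ⌈ x / d ⌉ ℤ.≤ ⌈ y / d ⌉
  ceil-mono {x} {y} x≤y = ceil-≤ (ZP.≤-trans x≤y (≤-ceil-mult y))

  ceil-char : ∀ {x k e} → e < d → x ℤ.+ + e ≡ k ℤ.* + d → ⌈ x / d ⌉ ≡ k
  ceil-char {x} {k} {e} e<d eq = ZP.≤-antisym
    (ceil-≤ (subst (x ℤ.≤_) eq (ZP.i≤i+j x (+ e))))
    (quotient-≤ e<d (subst (ℤ._≤ ⌈ x / d ⌉ ℤ.* + d ℤ.+ + e) eq (ZP.+-monoˡ-≤ (+ e) (≤-ceil-mult x))))

  ceil-shift : ∀ c t → t < d → ⌈ + c ℤ.- + t / d ⌉ ≡ + (c / d) ℤ.+ ind (t ℕ.<ᵇ c % d)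
  ceil-shift c t t<d with t ℕ.<ᵇ c % d | NP.<ᵇ-reflects-< t (c % d)
  ... | true  | ofʸ t<r = ceil-char {x = + c ℤ.- + t} e<d (trans (ℕ-shift c t e _ split) (ZP.pos-* (q + 1) d))
    where
    r = c % d
    q = c / d
    r≤d = NP.<⇒≤ (ND.m%n<n c d)
    e = (d ∸ r) + t
    e<d : e < d
    e<d = subst (e <_) (NP.m∸n+n≡m r≤d) (NP.+-monoʳ-< (d ∸ r) t<r)
    regroup : ∀ r x y t → (r + x) + (y + t) ≡ (r + y) + x + t
    regroup = ℕ-Ring.solve-∀
    fold : ∀ d q t → d + q * d + t ≡ (q + 1) * d + t
    fold = ℕ-Ring.solve-∀
    split : c + e ≡ (q + 1) * d + t
    split = begin
      c + e                          ≡⟨ cong (_+ e) (ND.m≡m%n+[m/n]*n c d) ⟩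
      (r + q * d) + ((d ∸ r) + t)    ≡⟨ regroup r (q * d) (d ∸ r) t ⟩
      (r + (d ∸ r)) + q * d + t      ≡⟨ cong (λ z → z + q * d + t) (NP.m+[n∸m]≡n r≤d) ⟩
      d + q * d + t                  ≡⟨ fold d q t ⟩
      (q + 1) * d + t                ∎
  ... | false | ofⁿ t≮r =
    trans (ceil-char {x = + c ℤ.- + t} e<d (trans (ℕ-shift c t e _ split) (ZP.pos-* q d))) (sym (ZP.+-identityʳ (+ q)))
    where
    r = c % d
    q = c / d
    r≤t = NP.≮⇒≥ t≮r
    e = t ∸ r
    e<d : e < d
    e<d = NP.≤-<-trans (NP.m∸n≤m t r) t<d
    regroup : ∀ r x y → (r + x) + y ≡ x + (r + y)
    regroup = ℕ-Ring.solve-∀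
    split : c + e ≡ q * d + t
    split = begin
      c + e                  ≡⟨ cong (_+ e) (ND.m≡m%n+[m/n]*n c d) ⟩
      (r + q * d) + (t ∸ r)  ≡⟨ regroup r (q * d) (t ∸ r) ⟩
      q * d + (r + (t ∸ r))  ≡⟨ cong (λ z → q * d + z) (NP.m+[n∸m]≡n r≤t) ⟩
      q * d + t              ∎

  ceil-shift-stable : ∀ x {t m} → t ℤ.≤ m →
    (⌈ x ℤ.- t / d ⌉ ≡ ⌈ x ℤ.- m / d ⌉) ⇔ (x ℤ.- ⌈ x ℤ.- m / d ⌉ ℤ.* + d ℤ.≤ t)
  ceil-shift-stable x {t} {m} t≤m = mk⇔
    (λ eq → sub-swap x t Kd (subst (λ k → x ℤ.- t ℤ.≤ k ℤ.* + d) eq (≤-ceil-mult (x ℤ.- t))))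
    (λ le → ZP.≤-antisym (ceil-≤ (sub-swap x Kd t le)) (ceil-mono (ZP.+-monoʳ-≤ x (ZP.neg-mono-≤ t≤m))))
    where
    Kd = ⌈ x ℤ.- m / d ⌉ ℤ.* + d

  dFracPrime≤d : ∀ x → dFracPrime d x ℤ.≤ + d
  dFracPrime≤d x = sub-swap (+ d ℤ.+ + x) (+ d) (+ d ℤ.* ⌈ + x / d ⌉)
    (subst₂ ℤ._≤_ (sym (cancel (+ d) (+ x))) (ZP.*-comm ⌈ + x / d ⌉ (+ d)) (≤-ceil-mult (+ x)))
    where
    cancel : ∀ d x → (d ℤ.+ x) ℤ.- d ≡ x
    cancel = ℤ-Ring.solve-∀

≡ᵇ-true : ∀ {x y} → (x ℕ.≡ᵇ y) ≡ true → x ≡ y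
≡ᵇ-true {x} {y} eq = NP.≡ᵇ⇒≡ x y (subst T (sym eq) _)

ind-<ᵇ-step : ∀ t r → ind (t ℕ.<ᵇ r) ≡ ind (suc t ℕ.<ᵇ r) ℤ.+ ind (r ℕ.≡ᵇ suc t)
ind-<ᵇ-step t       zero          = refl
ind-<ᵇ-step zero    (suc zero)    = refl
ind-<ᵇ-step zero    (suc (suc r)) = refl
ind-<ᵇ-step (suc t) (suc r)       = ind-<ᵇ-step t r

anyBelow-witness : ∀ N P → anyBelow N P ≡ true → Σ[ l ∈ ℕ ] l < N × P l ≡ true
anyBelow-witness (suc N) P any with anyBelow N P in anyN | P N in PN
anyBelow-witness (suc N) P any  | true  | _    with anyBelow-witness N P anyN
... | l , l<N , Pl = l , NP.m<n⇒m<1+n l<N , Pl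
anyBelow-witness (suc N) P any  | false | true = N , NP.≤-refl , PN
anyBelow-witness (suc N) P ()   | false | false

AtMostOnceBelow : ℕ → (ℕ → Bool) → Set
AtMostOnceBelow N P = ∀ {l l'} → l < l' → l' < N → P l ≡ true → P l' ≡ true → ⊥

once-below : ∀ {N P} → AtMostOnceBelow (suc N) P → AtMostOnceBelow N P
once-below once l<l' l'<N = once l<l' (NP.m<n⇒m<1+n l'<N)

ind-anyBelow : ∀ N P → AtMostOnceBelow N P → ind (anyBelow N P) ≡ Σ< N (λ l → ind (P l))
ind-anyBelow zero    P once = refl
ind-anyBelow (suc N) P once with P N in PN
... | false = trans (cong ind (∨-identityʳ (anyBelow N P)))
                    (trans (ind-anyBelow N P (once-below once)) (sym (ZP.+-identityʳ _)))
... | true  = trans (cong ind (∨-zeroʳ (anyBelow N P))) (cong (ℤ._+ + 1) (sym none-below))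
  where
  none : anyBelow N P ≡ false
  none with anyBelow N P in anyN
  ... | false = refl
  ... | true with anyBelow-witness N P anyN
  ...   | l , l<N , Pl = ⊥-elim (once l<N NP.≤-refl Pl PN)
  none-below : Σ< N (λ l → ind (P l)) ≡ + 0
  none-below = trans (sym (ind-anyBelow N P (once-below once))) (cong ind none)

module Counting (r : ℕ → ℕ) where

  hits : ℕ → ℤ
  hits m = ind (anyBelow m (λ l → r l ℕ.≡ᵇ m))

  InjectiveBelow : ℕ → Set
  InjectiveBelow B = ∀ {l l'} → l < l' → l' < B → r l ≢ r l'

  injective-≤ : ∀ {B B'} → B ≤ B' → InjectiveBelow B' → InjectiveBelow B
  injective-≤ B≤B' inj l<l' l'<B = inj l<l' (NP.<-≤-trans l'<B B≤B')

  -- Σ_{l≤N} [N < r l] + Σ_{m≤N} δ_∈(m) = Σ_{m≤N} [m < r m]:  raising the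
  -- threshold from N to N + 1 loses exactly the l ≤ N with r l = N + 1,
  -- of which there is at most one, and there is one iff δ_∈(N + 1) = 1.
  count : ∀ N → InjectiveBelow (suc N) →
    Σ< (suc N) (λ l → ind (N ℕ.<ᵇ r l)) ℤ.+ Σ< (suc N) hits ≡ Σ< (suc N) (λ m → ind (m ℕ.<ᵇ r m))
  count zero    inj = ZP.+-identityʳ _
  count (suc N) inj = begin
    (A ℤ.+ E) ℤ.+ (H ℤ.+ hits (suc N))  ≡⟨ regroup A E H (hits (suc N)) ⟩
    (A ℤ.+ hits (suc N) ℤ.+ H) ℤ.+ E    ≡⟨ cong (λ z → (A ℤ.+ z ℤ.+ H) ℤ.+ E) hits≡ ⟩
    (A ℤ.+ B ℤ.+ H) ℤ.+ E               ≡⟨ cong (λ z → (z ℤ.+ H) ℤ.+ E) (sym lowered) ⟩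
    (Σ< (suc N) (λ l → ind (N ℕ.<ᵇ r l)) ℤ.+ H) ℤ.+ E
                                        ≡⟨ cong (ℤ._+ E) (count N (injective-≤ (NP.n≤1+n (suc N)) inj)) ⟩
    Σ< (suc N) (λ m → ind (m ℕ.<ᵇ r m)) ℤ.+ E ∎
    where
    A = Σ< (suc N) (λ l → ind (suc N ℕ.<ᵇ r l))
    B = Σ< (suc N) (λ l → ind (r l ℕ.≡ᵇ suc N))
    E = ind (suc N ℕ.<ᵇ r (suc N))
    H = Σ< (suc N) hits
    regroup : ∀ a e h x → (a ℤ.+ e) ℤ.+ (h ℤ.+ x) ≡ (a ℤ.+ x ℤ.+ h) ℤ.+ e
    regroup = ℤ-Ring.solve-∀
    lowered : Σ< (suc N) (λ l → ind (N ℕ.<ᵇ r l)) ≡ A ℤ.+ B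
    lowered = trans (Σ<-cong (suc N) (λ l _ → ind-<ᵇ-step N (r l))) (Σ<-+ (suc N) _ _)
    hits≡ : hits (suc N) ≡ B
    hits≡ = ind-anyBelow (suc N) _ λ {l} {l'} l<l' l'<1+N rl rl' →
      inj l<l' (NP.m<n⇒m<1+n l'<1+N)
          (trans (≡ᵇ-true rl) (sym (≡ᵇ-true rl')))

module Column (d : ℕ) .{{_ : NonZero d}} where
  open Ceiling d

  -- Both sides split by ceil-shift, and the indicator parts agree by count.
  column : ∀ (c : ℕ → ℕ) N → N < d → Counting.InjectiveBelow (λ l → c l % d) (suc N) →
    Σ< (suc N) (λ l → ⌈ + c l ℤ.- + N / d ⌉)
      ≡ Σ< (suc N) (λ m → ⌈ + c m ℤ.- + m / d ⌉ ℤ.- Counting.hits (λ l → c l % d) m)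
  column c N N<d inj = begin
    Σ< n (λ l → ⌈ + c l ℤ.- + N / d ⌉)          ≡⟨ Σ<-cong n (λ l _ → ceil-shift (c l) N N<d) ⟩
    Σ< n (λ l → Q l ℤ.+ ind (N ℕ.<ᵇ r l))        ≡⟨ Σ<-+ n Q _ ⟩
    Σ< n Q ℤ.+ Σ< n (λ l → ind (N ℕ.<ᵇ r l))    ≡⟨ cong (λ z → Σ< n Q ℤ.+ z) (move (count N inj)) ⟩
    Σ< n Q ℤ.+ (Σ< n D ℤ.- Σ< n hits)           ≡⟨ regroup (Σ< n Q) (Σ< n D) (Σ< n hits) ⟩
    (Σ< n Q ℤ.+ Σ< n D) ℤ.- Σ< n hits           ≡⟨ cong (ℤ._- Σ< n hits) (sym (Σ<-+ n Q D)) ⟩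
    Σ< n (λ m → Q m ℤ.+ D m) ℤ.- Σ< n hits      ≡⟨ sym (Σ<-- n _ hits) ⟩
    Σ< n (λ m → (Q m ℤ.+ D m) ℤ.- hits m)
                        ≡⟨ Σ<-cong n (λ m m<n → cong (ℤ._- hits m) (sym (ceil-shift (c m) m (NP.<-≤-trans m<n N<d)))) ⟩
    Σ< n (λ m → ⌈ + c m ℤ.- + m / d ⌉ ℤ.- hits m) ∎
    where
    n = suc N
    r : ℕ → ℕ
    r l = c l % d
    open Counting r
    Q D : ℕ → ℤ
    Q l = + (c l / d)
    D m = ind (m ℕ.<ᵇ r m)
    move : ∀ {x h s} → x ℤ.+ h ≡ s → x ≡ s ℤ.- h
    move {x} {h} eq = trans (sym (cancel x h)) (cong (ℤ._- h) eq)
      where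
      cancel : ∀ x h → (x ℤ.+ h) ℤ.- h ≡ x
      cancel = ℤ-Ring.solve-∀
    regroup : ∀ q s h → q ℤ.+ (s ℤ.- h) ≡ (q ℤ.+ s) ℤ.- h
    regroup = ℤ-Ring.solve-∀

%-≡⇒∣ : ∀ d .{{_ : NonZero d}} A X → (A + X) % d ≡ A % d → d ∣ X
%-≡⇒∣ d A X eq = divides ((A + X) / d ∸ A / d) (begin
  X                                                   ≡⟨ sym (NP.m+n∸m≡n A X) ⟩
  (A + X) ∸ A                                         ≡⟨ cong₂ _∸_ (ND.m≡m%n+[m/n]*n (A + X) d) (ND.m≡m%n+[m/n]*n A d) ⟩
  ((A + X) % d + (A + X) / d * d) ∸ (A % d + A / d * d) ≡⟨ cong (λ z → (z + (A + X) / d * d) ∸ (A % d + A / d * d)) eq ⟩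
  (A % d + (A + X) / d * d) ∸ (A % d + A / d * d)      ≡⟨ NP.[m+n]∸[m+o]≡n∸o (A % d) _ _ ⟩
  (A + X) / d * d ∸ A / d * d                         ≡⟨ sym (NP.*-distribʳ-∸ d ((A + X) / d) (A / d)) ⟩
  ((A + X) / d ∸ A / d) * d                           ∎)

residues-injective : ∀ p d .{{_ : NonZero d}} → Prime p → d < p → ∀ v →
  Counting.InjectiveBelow (λ l → (p * l + v) % d) d
residues-injective p d p-prime d<p v {l} {l'} l<l' l'<d eq =
  NP.<-irrefl refl (NP.<-≤-trans l'<d (NP.≤-trans d≤l'-l (NP.m∸n≤m l' l)))
  where
  pl≤pl' : p * l ≤ p * l'
  pl≤pl' = NP.*-monoʳ-≤ p (NP.<⇒≤ l<l')
  shifted : p * l' + v ≡ (p * l + v) + p * (l' ∸ l)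
  shifted = begin
    p * l' + v                    ≡⟨ cong (_+ v) (sym (NP.m+[n∸m]≡n pl≤pl')) ⟩
    p * l + (p * l' ∸ p * l) + v  ≡⟨ cong (λ z → p * l + z + v) (sym (NP.*-distribˡ-∸ p l' l)) ⟩
    p * l + p * (l' ∸ l) + v      ≡⟨ regroup (p * l) (p * (l' ∸ l)) v ⟩
    (p * l + v) + p * (l' ∸ l)    ∎
    where
    regroup : ∀ x y v → x + y + v ≡ (x + v) + y
    regroup = ℕ-Ring.solve-∀
  d∣p[l'-l] : d ∣ p * (l' ∸ l)
  d∣p[l'-l] = %-≡⇒∣ d (p * l + v) _ (trans (cong (_% d) (sym shifted)) (sym eq))
  instance
    l'-l≢0 : NonZero (l' ∸ l)
    l'-l≢0 = ℕ.>-nonZero (NP.m<n⇒0<n∸m l<l')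
  d≤l'-l : d ≤ l' ∸ l
  d≤l'-l = ∣⇒≤ (coprime-divisor (Coprimality.sym (prime⇒coprime p-prime d<p)) d∣p[l'-l])

-- For b < a, p^b·u ≡ R (mod q − 1) where R is u with its digit word rotated by b;
-- R < q forces R = u, and the digit u_b of u is the digit u_0 of R.
module Periodicity (p a u b : ℕ) .{{_ : NonZero p}} .{{_ : NonZero a}}
  (u+2≤q : u + 2 ≤ p ^ a)
  (b-period : (p ^ a ∸ 1) ∣ (p ^ b * u ∸ u))
  (b-minimal : ∀ c → 1 ≤ c → c < b → ¬ ((p ^ a ∸ 1) ∣ (p ^ c * u ∸ u))) where

  q = p ^ a
  Q = q ∸ 1

  1≤q : 1 ≤ q
  1≤q = NP.≤-trans (s≤s z≤n) (NP.≤-trans (NP.m≤n+m 2 u) u+2≤q)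

  u<Q : u < Q
  u<Q = subst (_≤ Q) (cong (_∸ 1) (NP.+-comm u 2)) (NP.∸-monoˡ-≤ 1 u+2≤q)

  private instance
    Q-nonZero : NonZero Q
    Q-nonZero = ℕ.>-nonZero (NP.≤-<-trans z≤n u<Q)

  digitK-div : ∀ k v → digitK p k v ≡ (_/_ v (p ^ k) {{NP.m^n≢0 p k}}) % p
  digitK-div zero    v = cong (_% p) (sym (ND.n/1≡n v))
  digitK-div (suc k) v = trans (digitK-div k (v / p))
    (cong (_% p) (ND.m/n/o≡m/[n*o] v p (p ^ k) {{_}} {{NP.m^n≢0 p k}} {{NP.m^n≢0 p (suc k)}}))

  period-mod : (p ^ b * u) % Q ≡ u % Q
  period-mod = trans (cong (_% Q) (sym (NP.m∸n+n≡m (NP.m≤n*m u (p ^ b) {{NP.m^n≢0 p b}})))) (ND.%-remove-+ˡ u b-period)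

  -- Minimality of b, tested at c = a, gives b ≤ a.
  b≤a : b ≤ a
  b≤a = NP.≮⇒≥ λ a<b → b-minimal a (ℕ.>-nonZero⁻¹ a) a<b (subst (Q ∣_) Qu≡ (m∣m*n u))
    where
    Qu≡ : Q * u ≡ q * u ∸ u
    Qu≡ = trans (NP.*-distribʳ-∸ u q 1) (cong (q * u ∸_) (NP.*-identityˡ u))

  module Rotation (b<a : b < a) where
    s = a ∸ suc b
    pb = p ^ b
    ps = p ^ suc s

    instance
      pb-nonZero : NonZero pb
      pb-nonZero = NP.m^n≢0 p b
      ps-nonZero : NonZero ps
      ps-nonZero = NP.m^n≢0 p (suc s)

    L = u % ps
    H = u / ps
    R = L * pb + H

    q≡ : q ≡ pb * ps
    q≡ = trans (cong (p ^_) (sym (trans (NP.+-suc b s) (NP.m+[n∸m]≡n b<a)))) (NP.^-distribˡ-+-* p b (suc s))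

    H<pb : H < pb
    H<pb = ND.m<n*o⇒m/o<n (subst (u <_) q≡ (NP.<-≤-trans u<Q (NP.m∸n≤m q 1)))

    rotate : pb * u ≡ R + H * Q
    rotate = begin
      pb * u                  ≡⟨ cong (pb *_) (ND.m≡m%n+[m/n]*n u ps) ⟩
      pb * (L + H * ps)       ≡⟨ expand L H pb ps ⟩
      L * pb + H * (pb * ps)  ≡⟨ cong (λ z → L * pb + H * z) (trans (sym q≡) (sym (NP.m∸n+n≡m 1≤q))) ⟩
      L * pb + H * (Q + 1)    ≡⟨ fold L pb H Q ⟩
      R + H * Q               ∎
      where
      expand : ∀ L H pb ps → pb * (L + H * ps) ≡ L * pb + H * (pb * ps)
      expand = ℕ-Ring.solve-∀
      fold : ∀ L pb H Q → L * pb + H * (Q + 1) ≡ (L * pb + H) + H * Q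
      fold = ℕ-Ring.solve-∀

    R<q : R < q
    R<q = NP.<-≤-trans (NP.+-monoʳ-< (L * pb) H<pb)
      (subst₂ _≤_ (NP.+-comm pb (L * pb)) (trans (NP.*-comm ps pb) (sym q≡)) (NP.*-monoˡ-≤ pb (ND.m%n<n u ps)))

    R%Q≡u : R % Q ≡ u
    R%Q≡u = begin
      R % Q            ≡⟨ sym (ND.[m+kn]%n≡m%n R H Q) ⟩
      (R + H * Q) % Q  ≡⟨ cong (_% Q) (sym rotate) ⟩
      (pb * u) % Q     ≡⟨ period-mod ⟩
      u % Q            ≡⟨ ND.m<n⇒m%n≡m u<Q ⟩
      u                ∎

    R≡u : R ≡ u
    R≡u with NP.m≤n⇒m<n∨m≡n (NP.∸-monoˡ-≤ 1 R<q)
    ... | inj₁ R<Q = trans (sym (ND.m<n⇒m%n≡m R<Q)) R%Q≡u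
    ... | inj₂ R≡Q = ⊥-elim (ℕ.≢-nonZero⁻¹ Q (trans (sym R≡Q) R≡0))
      where
      u≡0 : u ≡ 0
      u≡0 = trans (sym R%Q≡u) (trans (cong (_% Q) R≡Q) (ND.n%n≡0 Q))
      R≡0 : R ≡ 0
      R≡0 = NP.m+n≡0⇒m≡0 R (trans (sym rotate) (trans (cong (pb *_) u≡0) (NP.*-zeroʳ pb)))

    digit-b≡digit-0 : digitK p b u ≡ digitK p 0 u
    digit-b≡digit-0 = begin
      digitK p b u            ≡⟨ digitK-div b u ⟩
      (u / pb) % p            ≡⟨ cong (λ v → (v / pb) % p) (sym R≡u) ⟩
      (R / pb) % p            ≡⟨ cong (_% p) R/pb≡L ⟩
      u % ps % p              ≡⟨ ND.m∣n⇒o%n%m≡o%m p ps u (m∣m*n (p ^ s)) ⟩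
      u % p                   ∎
      where
      R/pb≡L : R / pb ≡ L
      R/pb≡L = begin
        (L * pb + H) / pb     ≡⟨ ND.+-distrib-/-∣ˡ H {pb} (n∣m*n L) ⟩
        L * pb / pb + H / pb  ≡⟨ cong₂ _+_ (ND.m*n/n≡m L pb) (ND.m<n⇒m/n≡0 H<pb) ⟩
        L + 0                 ≡⟨ NP.+-identityʳ L ⟩
        L                     ∎

  -- u_b = u_0; for b = a this is periodicity of the digit extension itself.
  period : udig p a u b ≡ udig p a u 0
  period with NP.m≤n⇒m<n∨m≡n b≤a
  ... | inj₁ b<a = begin
    digitK p (b % a) u  ≡⟨ cong (λ j → digitK p j u) (ND.m<n⇒m%n≡m b<a) ⟩
    digitK p b u        ≡⟨ Rotation.digit-b≡digit-0 b<a ⟩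
    digitK p 0 u        ≡⟨ cong (λ j → digitK p j u) (sym (ND.m<n⇒m%n≡m (ℕ.>-nonZero⁻¹ a))) ⟩
    digitK p (0 % a) u  ∎
  ... | inj₂ refl = cong (λ j → digitK p j u) (trans (ND.n%n≡0 a) (sym (ND.m<n⇒m%n≡m (ℕ.>-nonZero⁻¹ a))))

module Fractions where

  toℚᵘ-/ : ∀ z k → ℚ.toℚᵘ (z ℚ./ suc k) U.≃ mkℚᵘ z k
  toℚᵘ-/ z k = QP.toℚᵘ-fromℚᵘ (mkℚᵘ z k)

  /1-mono : ∀ {x y} → x ℤ.≤ y → x ℚ./ 1 ℚ.≤ y ℚ./ 1
  /1-mono {x} {y} x≤y = QP.toℚᵘ-cancel-≤
    (UP.≤-respˡ-≃ (UP.≃-sym (toℚᵘ-/ x 0))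
      (UP.≤-respʳ-≃ (UP.≃-sym (toℚᵘ-/ y 0)) (*≤* (ZP.*-monoʳ-≤-nonNeg (+ 1) x≤y))))

  /1-injective : ∀ {x y} → x ℚ./ 1 ≡ y ℚ./ 1 → x ≡ y
  /1-injective {x} {y} eq with UP.≃-trans (UP.≃-sym (toℚᵘ-/ x 0)) (UP.≃-trans (QP.toℚᵘ-cong eq) (toℚᵘ-/ y 0))
  ... | *≡* x·1≡y·1 = trans (sym (ZP.*-identityʳ x)) (trans x·1≡y·1 (ZP.*-identityʳ y))

  /1-+ : ∀ x y → x ℚ./ 1 ℚ.+ y ℚ./ 1 ≡ (x ℤ.+ y) ℚ./ 1
  /1-+ x y = QP.toℚᵘ-injective (UP.≃-trans (QP.toℚᵘ-homo-+ (x ℚ./ 1) (y ℚ./ 1))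
    (UP.≃-trans (UP.+-cong (toℚᵘ-/ x 0) (toℚᵘ-/ y 0))
      (UP.≃-trans (*≡* (sum x y)) (UP.≃-sym (toℚᵘ-/ (x ℤ.+ y) 0)))))
    where
    sum : ∀ x y → (x ℤ.* + 1 ℤ.+ y ℤ.* + 1) ℤ.* + 1 ≡ (x ℤ.+ y) ℤ.* + 1
    sum = ℤ-Ring.solve-∀

  scale-/ : ∀ k z → (+ suc k ℚ./ 1) ℚ.* (z ℚ./ suc k) ≡ z ℚ./ 1
  scale-/ k z = QP.toℚᵘ-injective (UP.≃-trans (QP.toℚᵘ-homo-* (+ suc k ℚ./ 1) (z ℚ./ suc k))
    (UP.≃-trans (UP.*-cong (toℚᵘ-/ (+ suc k) 0) (toℚᵘ-/ z k)) (UP.≃-trans (*≡* cross) (UP.≃-sym (toℚᵘ-/ z 0)))))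
    where
    swap : ∀ s z → (s ℤ.* z) ℤ.* + 1 ≡ z ℤ.* s
    swap = ℤ-Ring.solve-∀
    cross : (+ suc k ℤ.* z) ℤ.* + 1 ≡ z ℤ.* + suc (k + 0)
    cross = trans (swap (+ suc k) z) (cong (λ j → z ℤ.* + suc j) (sym (NP.+-identityʳ k)))

  scale-Σ<ℚ : ∀ k n (Z : ℕ → ℤ) → (+ suc k ℚ./ 1) ℚ.* Σ<ℚ n (λ m → Z m ℚ./ suc k) ≡ Σ< n Z ℚ./ 1
  scale-Σ<ℚ k zero    Z = trans (QP.*-zeroʳ (+ suc k ℚ./ 1)) (sym (QP.0/n≡0 1))
  scale-Σ<ℚ k (suc n) Z = trans (QP.*-distribˡ-+ (+ suc k ℚ./ 1) _ _)
    (trans (cong₂ ℚ._+_ (scale-Σ<ℚ k n Z) (scale-/ k (Z n))) (/1-+ (Σ< n Z) (Z n)))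

  /-≥⇔ : ∀ x y z k → ((x ℚ./ suc k) ℚ.≥ (y ℚ./ suc k) ℚ.- (z ℚ./ 1)) ⇔ (y ℤ.- z ℤ.* + suc k ℤ.≤ x)
  /-≥⇔ x y z k = mk⇔
    (λ le → cross-multiply (UP.≤-respˡ-≃ difference (UP.≤-respʳ-≃ (toℚᵘ-/ x k) (QP.toℚᵘ-mono-≤ le))))
    (λ le → QP.toℚᵘ-cancel-≤ (UP.≤-respˡ-≃ (UP.≃-sym difference)
              (UP.≤-respʳ-≃ (UP.≃-sym (toℚᵘ-/ x k)) (*≤* (ZP.*-monoʳ-≤-nonNeg (+ suc k) le)))))
    where
    cross-multiply : mkℚᵘ (y ℤ.- z ℤ.* + suc k) k U.≤ mkℚᵘ x k → y ℤ.- z ℤ.* + suc k ℤ.≤ x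
    cross-multiply (*≤* le) = ZP.*-cancelʳ-≤-pos _ _ (+ suc k) le
    expand : ∀ y z s → (y ℤ.* + 1 ℤ.+ (- z) ℤ.* s) ℤ.* s ≡ (y ℤ.- z ℤ.* s) ℤ.* s
    expand = ℤ-Ring.solve-∀
    difference : ℚ.toℚᵘ ((y ℚ./ suc k) ℚ.- (z ℚ./ 1)) U.≃ mkℚᵘ (y ℤ.- z ℤ.* + suc k) k
    difference = UP.≃-trans (QP.toℚᵘ-homo-+ (y ℚ./ suc k) (ℚ.- (z ℚ./ 1)))
      (UP.≃-trans (UP.+-cong (toℚᵘ-/ y k) (UP.≃-trans (QP.toℚᵘ-homo‿- (z ℚ./ 1)) (UP.-‿cong (toℚᵘ-/ z 0))))
        (*≡* (trans (expand y z (+ suc k)) (cong (λ j → (y ℤ.- z ℤ.* + suc k) ℤ.* + suc j) (sym (NP.*-identityʳ k))))))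

minFrom1≤first : ∀ f k → minFrom1 f k ℤ.≤ f 1
minFrom1≤first f zero    = ZP.≤-refl
minFrom1≤first f (suc k) = ZP.≤-trans (ZP.i⊓j≤i (minFrom1 f k) _) (minFrom1≤first f k)

-- The setting of the theorem, with d = d' + 1, b = b' + 1 and n = N + 1 ≤ d − 1.
module Theorem (p a d' u b' : ℕ) .{{_ : NonZero p}} .{{_ : NonZero a}} (p-prime : Prime p)
  (u+2≤q : u + 2 ≤ p ^ a)
  (b-period : (p ^ a ∸ 1) ∣ (p ^ suc b' * u ∸ u))
  (b-minimal : ∀ c → 1 ≤ c → c < suc b' → ¬ ((p ^ a ∸ 1) ∣ (p ^ c * u ∸ u)))
  (p-large : + (4 * suc d') ℤ.- epsilon p a (suc d') u (suc b') ℤ.< + p)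
  (N : ℕ) (n<d : suc N ≤ d') (τ : Permutation′ (suc N)) where

  d = suc d'
  b = suc b'
  n = suc N

  open Ceiling d
  open Column d
  open Fractions
  open Periodicity p a u b u+2≤q b-period b-minimal using (period)

  N<d : N < d
  N<d = NP.m≤n⇒m≤1+n n<d

  -- ε ≤ d, so p > 4d − ε ≥ 3d ≥ d.
  d<p : d < p
  d<p = NP.≤-<-trans (NP.m≤n*m d 3) (ZP.drop‿+<+ (ZP.≤-<-trans 3d≤4d-ε p-large))
    where
    ε≤d : epsilon p a d u b ℤ.≤ + d
    ε≤d = ZP.≤-trans (minFrom1≤first _ b') (dFracPrime≤d (udig p a u 1))
    four : ∀ d → 4 * d ≡ 3 * d + d
    four = ℕ-Ring.solve-∀
    3d≤4d-ε : + (3 * d) ℤ.≤ + (4 * d) ℤ.- epsilon p a d u b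
    3d≤4d-ε = subst (ℤ._≤ + (4 * d) ℤ.- epsilon p a d u b)
      (trans (cong (λ z → + z ℤ.- + d) (four d)) (pos-+-minus (3 * d) d))
      (ZP.+-monoʳ-≤ (+ (4 * d)) (ZP.neg-mono-≤ ε≤d))

  cell : ℕ → ℕ → ℕ
  cell j l = p * l + udig p a u j

  residues : ℕ → ℕ → ℕ
  residues j l = cell j l % d

  residues-inj : ∀ j → Counting.InjectiveBelow (residues j) n
  residues-inj j = Counting.injective-≤ (residues j) N<d (residues-injective p d p-prime d<p (udig p a u j))

  low : ℕ → ℕ → ℤ
  low j l = ⌈ + cell j l ℤ.- + N / d ⌉

  low-column-of : ℕ → ℤ
  low-column-of v = Σ< n (λ l → ⌈ + (p * l + v) ℤ.- + N / d ⌉)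

  low-column : ℕ → ℤ
  low-column j = low-column-of (udig p a u j)

  term : ℕ → Fin n → ℤ
  term i' l = ⌈ + cell (b ∸ suc i') (toℕ l) ℤ.- + τat τ l / d ⌉

  τ≤N : ∀ l → τat τ l ≤ N
  τ≤N l = NP.≤-pred (FP.toℕ<n (τ ⟨$⟩ʳ l))

  low≤term : ∀ i' l → low (b ∸ suc i') (toℕ l) ℤ.≤ term i' l
  low≤term i' l = ceil-mono (ZP.+-monoʳ-≤ (+ cell (b ∸ suc i') (toℕ l)) (ZP.neg-mono-≤ (+≤+ (τ≤N l))))

  delta≡hits : ∀ i m → m < d → delta p a d u b i m ≡ Counting.hits (residues (b ∸ i)) m
  delta≡hits i zero    _   = refl
  delta≡hits i (suc m) m<d = cong (Counting.hits (residues (b ∸ i))) (ND.m<n⇒m%n≡m m<d)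

  polygon-column : ∀ i →
    Σ< n (λ m → ⌈ + ((p ∸ 1) * m + udig p a u (b ∸ i)) / d ⌉ ℤ.- delta p a d u b i m) ≡ low-column (b ∸ i)
  polygon-column i = sym (trans (column (cell (b ∸ i)) N N<d (residues-inj (b ∸ i)))
    (Σ<-cong n λ m m<n → cong₂ ℤ._-_ (cong (λ z → ⌈ z / d ⌉) (numerator m))
                                     (sym (delta≡hits i m (NP.<-≤-trans m<n N<d)))))
    where
    v = udig p a u (b ∸ i)
    peel : ∀ k m v → suc k * m + v ≡ (k * m + v) + m
    peel = ℕ-Ring.solve-∀
    numerator : ∀ m → + cell (b ∸ i) m ℤ.- + m ≡ + ((p ∸ 1) * m + v)
    numerator m = trans (cong (λ z → + (z * m + v) ℤ.- + m) (sym (NP.suc-pred p)))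
                        (trans (cong (λ z → + z ℤ.- + m) (peel (p ∸ 1) m v)) (pos-+-minus _ m))

  polygon : ((+ b) ℚ./ 1) ℚ.* Ppoly p a d u b n ≡ Σ< b (λ i' → low-column (b ∸ suc i')) ℚ./ 1
  polygon = trans (scale-Σ<ℚ b' n (λ m → Σ< b (W m))) (cong (ℚ._/ 1) (begin
    Σ< n (λ m → Σ< b (W m))                ≡⟨ Σ<-swap n b W ⟩
    Σ< b (λ i → Σ< n (λ m → W m i))        ≡⟨ Σ<-cong b (λ i _ → polygon-column i) ⟩
    Σ< b (λ i → low-column (b ∸ i))        ≡⟨ Σ<-rotate b low-column (cong low-column-of period) ⟩
    Σ< b (λ i → low-column (b ∸ suc i))    ∎))
    where
    W : ℕ → ℕ → ℤ
    W m i = ⌈ + ((p ∸ 1) * m + udig p a u (b ∸ i)) / d ⌉ ℤ.- delta p a d u b i m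

  low-total : Σ< b (λ i' → low-column (b ∸ suc i')) ≡ Σ< b (λ i' → ΣFin n (λ l → low (b ∸ suc i') (toℕ l)))
  low-total = Σ<-cong b (λ i' _ → sym (ΣFin-toℕ n (low (b ∸ suc i'))))

  lower-bound : (lhsSum p a d u b n τ ℚ./ 1) ℚ.≥ ((+ b) ℚ./ 1) ℚ.* Ppoly p a d u b n
  lower-bound = subst (ℚ._≤ lhsSum p a d u b n τ ℚ./ 1) (sym polygon)
    (/1-mono (subst (ℤ._≤ lhsSum p a d u b n τ) (sym low-total)
      (Σ<-mono b (λ i' _ → ΣFin-mono n (low≤term i')))))

  attained⇔cells : (lhsSum p a d u b n τ ≡ Σ< b (λ i' → low-column (b ∸ suc i')))
                   ⇔ (∀ i' → i' < b → ∀ l → term i' l ≡ low (b ∸ suc i') (toℕ l))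
  attained⇔cells = mk⇔
    (λ eq i' i'<b → ΣFin-tight n (low≤term i')
      (Σ<-tight b (λ j _ → ΣFin-mono n (low≤term j)) (trans eq low-total) i' i'<b))
    (λ cells → trans (Σ<-cong b (λ i' i'<b → ΣFin-cong n (cells i' i'<b))) (sym low-total))

  cell⇔inS : ∀ i' l → (term i' l ≡ low (b ∸ suc i') (toℕ l))
    ⇔ ((+ τat τ l) ℚ./ d ℚ.≥ ((+ cell (b ∸ suc i') (toℕ l)) ℚ./ d) ℚ.- (low (b ∸ suc i') (toℕ l) ℚ./ 1))
  cell⇔inS i' l = ⇔.trans (ceil-shift-stable (+ cell (b ∸ suc i') (toℕ l)) (+≤+ (τ≤N l)))
                          (⇔.sym (/-≥⇔ (+ τat τ l) (+ cell (b ∸ suc i') (toℕ l)) (low (b ∸ suc i') (toℕ l)) d'))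

  equality⇔inS : (lhsSum p a d u b n τ ℚ./ 1 ≡ ((+ b) ℚ./ 1) ℚ.* Ppoly p a d u b n)
                 ⇔ (∀ i → 1 ≤ i → i ≤ b → inS p a d u b n i τ)
  equality⇔inS = mk⇔
    (λ { eq (suc i') _ i≤b l → to (cell⇔inS i' l) (to attained⇔cells (/1-injective (trans eq polygon)) i' i≤b l) })
    (λ inS-all → trans (cong (ℚ._/ 1) (from attained⇔cells λ i' i'<b l →
                   from (cell⇔inS i' l) (inS-all (suc i') (s≤s z≤n) i'<b l))) (sym polygon))

mainTheorem11 : (p a d u b : ℕ) → Prime p → .{{_ : NonZero p}} →
    .{{_ : NonZero a}} → .{{_ : NonZero d}} →
    u + 2 ≤ p ^ a →
    .{{_ : NonZero b}} →
    (p ^ a ∸ 1) ∣ (p ^ b * u ∸ u) →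
    ((c : ℕ) → 1 ≤ c → c < b → ¬ ((p ^ a ∸ 1) ∣ (p ^ c * u ∸ u))) →
    (+ (4 * d)) ℤ.- epsilon p a d u b ℤ.< + p →
    (n : ℕ) → 1 ≤ n → n ≤ d ∸ 1 →
    (τ : Permutation′ n) →
    ((lhsSum p a d u b n τ ℚ./ 1) ℚ.≥ ((+ b) ℚ./ 1) ℚ.* Ppoly p a d u b n)
    × ((lhsSum p a d u b n τ ℚ./ 1 ≡ ((+ b) ℚ./ 1) ℚ.* Ppoly p a d u b n)
       ⇔ ((i : ℕ) → 1 ≤ i → i ≤ b → inS p a d u b n i τ))
mainTheorem11 p a zero     u b        p-prime {{_}} {{_}} {{()}}
mainTheorem11 p a (suc d') u zero     p-prime u+2≤q {{()}}
mainTheorem11 p a (suc d') u (suc b') p-prime u+2≤q b-period b-minimal p-large zero    () n≤d-1 τ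
mainTheorem11 p a (suc d') u (suc b') p-prime u+2≤q b-period b-minimal p-large (suc N) _  n≤d-1 τ =
  lower-bound , equality⇔inS
  where open Theorem p a d' u b' p-prime u+2≤q b-period b-minimal p-large N n≤d-1 τ
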